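{- Neither $\Gamma_1$ nor $\Gamma_2$ is reducible to an even subdivision of $K_{3,3}$.
   Context: $\Gamma_1$ has vertices $a,\dots,l$ and edges $ab,bc,cd,de,ef,fg,gh,hi,ij,jk,kl,la,ad,je,bg,hk,ic,fl$. $\Gamma_2$ has vertices $a,\dots,l$ and edges $ab,bc,cd,de,ef,fg,gh,hi,ij,jk,kl,la,el,hd,kg,ai,fb,cj$. A graph $G$ is simply reducible to $H$ if $G$ has a circuit $X$ of odd length such that $H$ is obtained from $G$ by contracting $X$ to a single vertex; $G$ is reducible to $H$ if there are graphs $G=G_0,\dots,G_k=H$ ($k\ge1$) with each $G_{i-1}$ simply reducible to $G_i$. An even subdivision of a graph is obtained by a finite sequence (at least one) of replacements of an edge $vw$ by a path of odd length from $v$ to $w$ with new internal vertices. -}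

module Defs where

open import Data.Nat using (ℕ; zero; suc; _+_; _<?_)
open import Data.Nat.DivMod using (_mod_)
open import Data.Fin using (Fin; zero; suc; toℕ; fromℕ<; _↑ˡ_; _↑ʳ_; splitAt; #_; _≟_)
open import Data.Vec using (Vec; lookup; []; _∷_)
open import Data.Product using (Σ; ∃; _×_; _,_; proj₁; proj₂)
open import Data.Sum using (_⊎_; inj₁; inj₂)
open import Relation.Nullary using (¬_; yes; no)
open import Relation.Binary.PropositionalEquality using (_≡_)
open import Function.Bundles using (_↔_; Inverse)
open import Function.Definitions using (Injective; Surjective)

Even : ℕ → Set
Even k = ∃ λ t → k ≡ t + t

Odd : ℕ → Set
Odd k = ∃ λ t → k ≡ suc (t + t)

-- Finite (multi)graphs: vertices Fin n, edges Fin m, each edge has an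
-- (unordered) pair of ends.  Loops and parallel edges are allowed, since
-- contracting a circuit may create them.

record Graph : Set where
  field
    n    : ℕ
    m    : ℕ
    ends : Fin m → Fin n × Fin n
open Graph public

Vertex : Graph → Set
Vertex G = Fin (n G)

Edge : Graph → Set
Edge G = Fin (m G)

SameEnds : ∀ {A : Set} → A × A → A × A → Set
SameEnds (a , b) (c , d) = (a ≡ c × b ≡ d) ⊎ (a ≡ d × b ≡ c)

mapEnds : ∀ {A B : Set} → (A → B) → A × A → B × B
mapEnds f (a , b) = f a , f b

Joins : (G : Graph) → Edge G → Vertex G → Vertex G → Set
Joins G e u v = SameEnds (ends G e) (u , v)

record _≅_ (G H : Graph) : Set where
  field
    vmap : Vertex G ↔ Vertex H
    emap : Edge G ↔ Edge H
    inc  : ∀ e → SameEnds (mapEnds (Inverse.to vmap) (ends G e))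
                          (ends H (Inverse.to emap e))

next : ∀ {k} → Fin (suc k) → Fin (suc k)
next {k} i = suc (toℕ i) mod suc k

record Circuit (G : Graph) : Set where
  field
    k     : ℕ                      -- length is suc k
    verts : Fin (suc k) → Vertex G
    edges : Fin (suc k) → Edge G
    verts-inj : Injective _≡_ _≡_ verts
    edges-inj : Injective _≡_ _≡_ edges
    joins : ∀ i → Joins G (edges i) (verts i) (verts (next i))

length : ∀ {G} → Circuit G → ℕ
length X = suc (Circuit.k X)

OnCircuit : ∀ {G} → Circuit G → Vertex G → Set
OnCircuit X v = ∃ λ i → Circuit.verts X i ≡ v

EdgeOfCircuit : ∀ {G} → Circuit G → Edge G → Set
EdgeOfCircuit X e = ∃ λ i → Circuit.edges X i ≡ e

-- H is (up to relabelling) obtained from G by contracting the circuit X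
-- to a single vertex: the vertices of X are identified (and only those),
-- the edges of X are deleted, all other edges are kept with their ends
-- mapped accordingly (chords become loops, parallel edges are kept).
record ContractsTo (G : Graph) (X : Circuit G) (H : Graph) : Set where
  field
    φ      : Vertex G → Vertex H
    φ-surj : Surjective _≡_ _≡_ φ
    φ-id   : ∀ u v → φ u ≡ φ v → u ≡ v ⊎ (OnCircuit X u × OnCircuit X v)
    φ-X    : ∀ u v → OnCircuit X u → OnCircuit X v → φ u ≡ φ v
    ψ      : (Σ (Edge G) λ e → ¬ EdgeOfCircuit X e) ↔ Edge H
    ψ-inc  : ∀ e → SameEnds (mapEnds φ (ends G (proj₁ e)))
                            (ends H (Inverse.to ψ e))

SimplyReducible : Graph → Graph → Set
SimplyReducible G H = Σ (Circuit G) λ X → Odd (length X) × ContractsTo G X H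

data Reducible : Graph → Graph → Set where
  one  : ∀ {G H} → SimplyReducible G H → Reducible G H
  more : ∀ {G G' H} → SimplyReducible G G' → Reducible G' H → Reducible G H

-- Subdividing edge e of G by a path of length suc j (j new vertices).

subdivide : (G : Graph) → Edge G → ℕ → Graph
subdivide G e j = record { n = n G + j ; m = m G + j ; ends = ends' }
  where
  a = proj₁ (ends G e)
  b = proj₂ (ends G e)
  -- i-th internal vertex of the path for i < j, and the end b for i ≥ j
  node : ℕ → Fin (n G + j)
  node i with i <? j
  ... | yes p = n G ↑ʳ fromℕ< p
  ... | no _  = b ↑ˡ j
  ends' : Fin (m G + j) → Fin (n G + j) × Fin (n G + j)
  ends' f with splitAt (m G) f
  ... | inj₂ i = node (toℕ i) , node (suc (toℕ i))
  ... | inj₁ f' with f' ≟ e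
  ...   | yes _ = a ↑ˡ j , node 0
  ...   | no _  = mapEnds (_↑ˡ j) (ends G f')

-- H is an even subdivision of G: obtained (up to isomorphism) by a
-- nonempty finite sequence of replacements of an edge by a path of odd length
data EvenSubdivisionOf (G : Graph) : Graph → Set where
  step₁ : ∀ {H} (e : Edge G) (j : ℕ) → Even j → H ≅ subdivide G e j
        → EvenSubdivisionOf G H
  stepₙ : ∀ {H' H} → EvenSubdivisionOf G H' → (e : Edge H') (j : ℕ) → Even j
        → H ≅ subdivide H' e j → EvenSubdivisionOf G H

-- The specific graphs (vertices a,…,l ↦ 0,…,11)

K33 : Graph
K33 = record { n = 6 ; m = 9 ; ends = lookup es }
  where
  es : Vec (Fin 6 × Fin 6) 9
  es = (# 0 , # 3) ∷ (# 0 , # 4) ∷ (# 0 , # 5)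
     ∷ (# 1 , # 3) ∷ (# 1 , # 4) ∷ (# 1 , # 5)
     ∷ (# 2 , # 3) ∷ (# 2 , # 4) ∷ (# 2 , # 5) ∷ []

-- ab,bc,cd,de,ef,fg,gh,hi,ij,jk,kl,la,ad,je,bg,hk,ic,fl
Γ₁ : Graph
Γ₁ = record { n = 12 ; m = 18 ; ends = lookup es }
  where
  es : Vec (Fin 12 × Fin 12) 18
  es = (# 0 , # 1) ∷ (# 1 , # 2) ∷ (# 2 , # 3) ∷ (# 3 , # 4) ∷ (# 4 , # 5)
     ∷ (# 5 , # 6) ∷ (# 6 , # 7) ∷ (# 7 , # 8) ∷ (# 8 , # 9) ∷ (# 9 , # 10)
     ∷ (# 10 , # 11) ∷ (# 11 , # 0)
     ∷ (# 0 , # 3) ∷ (# 9 , # 4) ∷ (# 1 , # 6) ∷ (# 7 , # 10) ∷ (# 8 , # 2)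
     ∷ (# 5 , # 11) ∷ []

-- ab,bc,cd,de,ef,fg,gh,hi,ij,jk,kl,la,el,hd,kg,ai,fb,cj
Γ₂ : Graph
Γ₂ = record { n = 12 ; m = 18 ; ends = lookup es }
  where
  es : Vec (Fin 12 × Fin 12) 18
  es = (# 0 , # 1) ∷ (# 1 , # 2) ∷ (# 2 , # 3) ∷ (# 3 , # 4) ∷ (# 4 , # 5)
     ∷ (# 5 , # 6) ∷ (# 6 , # 7) ∷ (# 7 , # 8) ∷ (# 8 , # 9) ∷ (# 9 , # 10)
     ∷ (# 10 , # 11) ∷ (# 11 , # 0)
     ∷ (# 4 , # 11) ∷ (# 7 , # 3) ∷ (# 10 , # 6) ∷ (# 0 , # 8) ∷ (# 5 , # 1)
     ∷ (# 2 , # 9) ∷ []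

ReducibleToEvenSubdivisionOfK33 : Graph → Set
ReducibleToEvenSubdivisionOfK33 G = ∃ λ H → Reducible G H × EvenSubdivisionOf K33 H

{-# OPTIONS --safe #-}
module Submission where

-- A sequence of circuit contractions from G to H maps the vertices of G onto those of H
-- and every edge of G either to its own edge of H or to a single vertex.  An even
-- subdivision H of K₃,₃ is bipartite with |E(H)| = |V(H)| + 3 and |V(H)| ≥ 6.  Pull its
-- 2-colouring back to a colouring χ of G: bichromatic edges of G survive as distinct
-- edges of H, and monochromatic ones are contracted.  So |V(H)| is at most the number c
-- of components of the monochromatic subgraph, and the number b of bichromatic edges is
-- at most |V(H)| + 3, giving 6 ≤ c and b ≤ c + 3.  For Γ₁ and Γ₂, checking all 2¹²
-- colourings shows that c < 6 or b > c + 3 every time.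

open import Defs
open import Data.Product using (_×_)
open import Relation.Nullary using (¬_)

open import Data.Bool as Bool using (Bool; true; false; T; not; _∧_; _∨_; if_then_else_)
open import Data.Bool.Properties using (T-∨; T-≡; ∧-conicalˡ; ∧-conicalʳ; not-¬; not-involutive)
open import Data.Fin using (Fin; zero; suc; toℕ; fromℕ<; splitAt; _↑ˡ_; _↑ʳ_; _≟_)
open import Data.Fin.Patterns using (0F; 1F; 2F; 3F; 4F; 5F; 6F; 7F; 8F)
open import Data.Fin.Permutation using (↔⇒≡)
open import Data.Fin.Properties
  using (any?; injective⇒≤; suc-injective; splitAt-↑ˡ; splitAt-↑ʳ; toℕ-fromℕ<; toℕ<n)
open import Data.List using (List; []; _∷_; filter; allFin) renaming (map to mapᴸ)
open import Data.List.Relation.Unary.All as All using (All; []; _∷_)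
open import Data.List.Relation.Unary.All.Properties using (map⁺; all-filter)
open import Data.Maybe using (Maybe; just; nothing; _>>=_)
open import Data.Maybe.Properties using (just-injective)
open import Data.Nat using (ℕ; zero; suc; _+_; _≤_; _<_; _<?_; _<ᵇ_)
open import Data.Nat.Properties
  using (≤-refl; ≤-trans; ≤-antisym; ≮⇒≥; <⇒≱; <ᵇ⇒<; m≤m+n; +-suc; +-monoˡ-≤)
open import Algebra.Properties.CommutativeSemigroup
  Data.Nat.Properties.+-commutativeSemigroup using (xy∙z≈xz∙y)
open import Data.Product using (∃; _,_; proj₁; proj₂)
open import Data.Sum using (inj₁; inj₂; [_,_]′)
open import Data.Vec using (Vec; []; _∷_; lookup; tabulate) renaming (map to mapⱽ)
open import Data.Vec.Properties using (lookup-map; lookup∘tabulate)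
open import Function using (_∘_; id)
open import Function.Bundles using (Equivalence; Inverse; Injection)
import Function.Construct.Composition as Composition
open import Function.Definitions using (Injective; Surjective)
open import Function.Properties.Inverse using (↔⇒↣)
open import Relation.Binary.PropositionalEquality
open import Relation.Nullary using (Dec; yes; no; does; isYes; isNo; contradiction)
open import Relation.Nullary.Decidable using (fromWitness; toWitnessFalse)

count : ∀ {n} → (Fin n → Bool) → ℕ
count {zero}  p = 0
count {suc n} p = if p zero then suc (count (p ∘ suc)) else count (p ∘ suc)

rank : ∀ {n} (p : Fin n → Bool) (i : Fin n) → T (p i) → Fin (count p)
rank p zero    pi with p zero
... | true  = zero
rank p (suc i) pi with p zero
... | true  = suc (rank (p ∘ suc) i pi)
... | false = rank (p ∘ suc) i pi

rank-injective : ∀ {n} (p : Fin n → Bool) {i j} (pi : T (p i)) (pj : T (p j)) →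
                 rank p i pi ≡ rank p j pj → i ≡ j
rank-injective p {zero}  {zero}  _  _  _  = refl
rank-injective p {zero}  {suc j} pi pj eq with p zero
rank-injective p {zero}  {suc j} pi pj () | true
rank-injective p {suc i} {zero}  pi pj eq with p zero
rank-injective p {suc i} {zero}  pi pj () | true
rank-injective p {suc i} {suc j} pi pj eq with p zero
... | true  = cong suc (rank-injective (p ∘ suc) pi pj (suc-injective eq))
... | false = cong suc (rank-injective (p ∘ suc) pi pj eq)

select : ∀ {n} (p : Fin n → Bool) → Fin (count p) → Fin n
select {suc n} p k with p zero
select {suc n} p zero    | true  = zero
select {suc n} p (suc k) | true  = suc (select (p ∘ suc) k)
select {suc n} p k       | false = suc (select (p ∘ suc) k)

select-member : ∀ {n} (p : Fin n → Bool) k → T (p (select p k))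
select-member {suc n} p k with p zero in p0
select-member {suc n} p zero    | true  = subst T (sym p0) _
select-member {suc n} p (suc k) | true  = select-member (p ∘ suc) k
select-member {suc n} p k       | false = select-member (p ∘ suc) k

select-injective : ∀ {n} (p : Fin n → Bool) → Injective _≡_ _≡_ (select p)
select-injective {suc n} p {k} {l} eq with p zero
select-injective {suc n} p {zero}  {zero}  eq | true  = refl
select-injective {suc n} p {suc k} {suc l} eq | true  =
  cong suc (select-injective (p ∘ suc) (suc-injective eq))
select-injective {suc n} p {k}     {l}     eq | false =
  select-injective (p ∘ suc) (suc-injective eq)

≤-count : ∀ {k n} (p : Fin n → Bool) {f : Fin k → Fin n} →
          Injective _≡_ _≡_ f → (∀ x → T (p (f x))) → k ≤ count p
≤-count p {f} f-injective f-member =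
  injective⇒≤ {f = λ x → rank p (f x) (f-member x)}
    (f-injective ∘ rank-injective p (f-member _) (f-member _))

count-≤ : ∀ {k n} (p : Fin n → Bool) (f : ∀ i → T (p i) → Fin k) →
          (∀ {i j} pi pj → f i pi ≡ f j pj → i ≡ j) → count p ≤ k
count-≤ p f f-injective =
  injective⇒≤ {f = λ l → f (select p l) (select-member p l)}
    (select-injective p ∘ f-injective _ _)

imageSize : ∀ {n k} → (Fin n → Fin k) → ℕ
imageSize r = count (λ u → isYes (any? (λ v → r v ≟ u)))

≤-imageSize : ∀ {n k l} (r : Fin n → Fin k) (φ : Fin k → Fin l) →
              Surjective _≡_ _≡_ (φ ∘ r) → l ≤ imageSize r
≤-imageSize r φ φ∘r-surjective =
  ≤-count _ {f = r ∘ preimage} preimage-injective (λ y → fromWitness (preimage y , refl))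
  where
  preimage : _ → _
  preimage y = proj₁ (φ∘r-surjective y)

  φ∘r∘preimage : ∀ y → φ (r (preimage y)) ≡ y
  φ∘r∘preimage y = proj₂ (φ∘r-surjective y) refl

  preimage-injective : Injective _≡_ _≡_ (r ∘ preimage)
  preimage-injective {y} {y'} eq =
    trans (sym (φ∘r∘preimage y)) (trans (cong φ eq) (φ∘r∘preimage y'))

Identifies : ∀ {A B : Set} → (A → B) → A × A → Set
Identifies f (u , v) = f u ≡ f v

module _ {A : Set} where

  SameEnds-sym : {x y : A × A} → SameEnds x y → SameEnds y x
  SameEnds-sym (inj₁ (refl , refl)) = inj₁ (refl , refl)
  SameEnds-sym (inj₂ (refl , refl)) = inj₂ (refl , refl)

  SameEnds-trans : {x y z : A × A} → SameEnds x y → SameEnds y z → SameEnds x z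
  SameEnds-trans (inj₁ (refl , refl)) y~z                  = y~z
  SameEnds-trans (inj₂ (refl , refl)) (inj₁ (refl , refl)) = inj₂ (refl , refl)
  SameEnds-trans (inj₂ (refl , refl)) (inj₂ (refl , refl)) = inj₁ (refl , refl)

  SameEnds-map : ∀ {B : Set} (f : A → B) {x y : A × A} →
                 SameEnds x y → SameEnds (mapEnds f x) (mapEnds f y)
  SameEnds-map f (inj₁ (refl , refl)) = inj₁ (refl , refl)
  SameEnds-map f (inj₂ (refl , refl)) = inj₂ (refl , refl)

  Identifies-resp-SameEnds : ∀ {B : Set} {f : A → B} {x y : A × A} →
                             SameEnds x y → Identifies f y → Identifies f x
  Identifies-resp-SameEnds (inj₁ (refl , refl)) fy = fy
  Identifies-resp-SameEnds (inj₂ (refl , refl)) fy = sym fy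

module _ {n : ℕ} where

  relabel : Fin n → Fin n → Vec (Fin n) n → Vec (Fin n) n
  relabel x y = mapⱽ (λ z → if does (z ≟ y) then x else z)

  merge : Fin n × Fin n → Vec (Fin n) n → Vec (Fin n) n
  merge (u , v) l = relabel (lookup l u) (lookup l v) l

  componentLabels : List (Fin n × Fin n) → Vec (Fin n) n
  componentLabels []       = tabulate id
  componentLabels (e ∷ es) = merge e (componentLabels es)

  relabel-respects : ∀ {B : Set} (φ : Fin n → B) {x y} → φ x ≡ φ y →
                     ∀ l w → φ (lookup (relabel x y l) w) ≡ φ (lookup l w)
  relabel-respects φ {x} {y} φx≡φy l w
    rewrite lookup-map w (λ z → if does (z ≟ y) then x else z) l
    with lookup l w ≟ y
  ... | yes refl = φx≡φy
  ... | no _     = refl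

  componentLabels-respect : ∀ {B : Set} (φ : Fin n → B) {es} → All (Identifies φ) es →
                            ∀ w → φ (lookup (componentLabels es) w) ≡ φ w
  componentLabels-respect φ []                      w = cong φ (lookup∘tabulate id w)
  componentLabels-respect φ {(u , v) ∷ es} (φu≡φv ∷ φ-es) w =
    trans (relabel-respects φ φlu≡φlv l w) (IH w)
    where
    l = componentLabels es
    IH = componentLabels-respect φ φ-es

    φlu≡φlv : φ (lookup l u) ≡ φ (lookup l v)
    φlu≡φlv = trans (IH u) (trans φu≡φv (sym (IH v)))

record Contraction (G H : Graph) : Set where
  field
    φ            : Vertex G → Vertex H
    φ-surjective : Surjective _≡_ _≡_ φ
    ψ            : Edge G → Maybe (Edge H)
    ψ-injective  : ∀ {e e' f} → ψ e ≡ just f → ψ e' ≡ just f → e ≡ e'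
    ψ-kept       : ∀ {e f} → ψ e ≡ just f → SameEnds (mapEnds φ (ends G e)) (ends H f)
    ψ-contracted : ∀ {e} → ψ e ≡ nothing → Identifies φ (ends G e)

contraction-trans : ∀ {G G' H} → Contraction G G' → Contraction G' H → Contraction G H
contraction-trans {G} {G'} {H} C D = record
  { φ            = D.φ ∘ C.φ
  ; φ-surjective = Composition.surjective _≡_ _≡_ _≡_ C.φ-surjective D.φ-surjective
  ; ψ            = ψ
  ; ψ-injective  = ψ-injective
  ; ψ-kept       = ψ-kept
  ; ψ-contracted = ψ-contracted
  }
  where
  module C = Contraction C
  module D = Contraction D

  ψ : Edge G → Maybe (Edge H)
  ψ e = C.ψ e >>= D.ψ

  ψ-injective : ∀ {e e' f} → ψ e ≡ just f → ψ e' ≡ just f → e ≡ e'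
  ψ-injective {e} {e'} eq eq' with C.ψ e in Ce | C.ψ e' in Ce'
  ... | just g | just g' = C.ψ-injective Ce (trans Ce' (cong just (D.ψ-injective eq' eq)))

  ψ-kept : ∀ {e f} → ψ e ≡ just f → SameEnds (mapEnds (D.φ ∘ C.φ) (ends G e)) (ends H f)
  ψ-kept {e} eq with C.ψ e in Ce
  ... | just g = SameEnds-trans (SameEnds-map D.φ (C.ψ-kept Ce)) (D.ψ-kept eq)

  ψ-contracted : ∀ {e} → ψ e ≡ nothing → Identifies (D.φ ∘ C.φ) (ends G e)
  ψ-contracted {e} eq with C.ψ e in Ce
  ... | nothing = cong D.φ (C.ψ-contracted Ce)
  ... | just g  = Identifies-resp-SameEnds {f = D.φ} (C.ψ-kept Ce) (D.ψ-contracted eq)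

EdgeOfCircuit? : ∀ {G} (X : Circuit G) e → Dec (EdgeOfCircuit X e)
EdgeOfCircuit? X e = any? (λ i → Circuit.edges X i ≟ e)

contractsTo⇒contraction : ∀ {G X H} → ContractsTo G X H → Contraction G H
contractsTo⇒contraction {G} {X} {H} G↠H = record
  { φ            = φ
  ; φ-surjective = φ-surj
  ; ψ            = λ e → keep e (EdgeOfCircuit? X e)
  ; ψ-injective  = λ {e} {e'} → ψ-injective (EdgeOfCircuit? X e) (EdgeOfCircuit? X e')
  ; ψ-kept       = λ {e} → ψ-kept (EdgeOfCircuit? X e)
  ; ψ-contracted = λ {e} → ψ-contracted (EdgeOfCircuit? X e)
  }
  where
  open ContractsTo G↠H renaming (ψ to ψ↔)

  keep : ∀ e → Dec (EdgeOfCircuit X e) → Maybe (Edge H)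
  keep e (yes _)  = nothing
  keep e (no e∉X) = just (Inverse.to ψ↔ (e , e∉X))

  ψ-injective : ∀ {e e' f} d d' → keep e d ≡ just f → keep e' d' ≡ just f → e ≡ e'
  ψ-injective (no e∉X) (no e'∉X) refl eq =
    cong proj₁ (Injection.injective (↔⇒↣ ψ↔) (just-injective (sym eq)))

  ψ-kept : ∀ {e f} d → keep e d ≡ just f → SameEnds (mapEnds φ (ends G e)) (ends H f)
  ψ-kept (no e∉X) refl = ψ-inc (_ , e∉X)

  ψ-contracted : ∀ {e} d → keep e d ≡ nothing → Identifies φ (ends G e)
  ψ-contracted (yes (i , refl)) _ =
    Identifies-resp-SameEnds {f = φ} (Circuit.joins X i) (φ-X _ _ (i , refl) (next i , refl))

reducible⇒contraction : ∀ {G H} → Reducible G H → Contraction G H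
reducible⇒contraction (one (_ , _ , G↠H))        = contractsTo⇒contraction G↠H
reducible⇒contraction (more (_ , _ , G↠G') G'↝H) =
  contraction-trans (contractsTo⇒contraction G↠G') (reducible⇒contraction G'↝H)

ProperColouring : (G : Graph) → (Vertex G → Bool) → Set
ProperColouring G c = ∀ f → ¬ Identifies c (ends G f)

record K33Invariants (H : Graph) : Set where
  field
    colour        : Vertex H → Bool
    colour-proper : ProperColouring H colour
    6≤n           : 6 ≤ n H
    m≡n+3         : m H ≡ n H + 3

K33Invariants-K33 : K33Invariants K33
K33Invariants-K33 = record
  { colour        = λ v → toℕ v <ᵇ 3
  ; colour-proper = λ { 0F → λ () ; 1F → λ () ; 2F → λ () ; 3F → λ () ; 4F → λ ()
                      ; 5F → λ () ; 6F → λ () ; 7F → λ () ; 8F → λ () }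
  ; 6≤n           = ≤-refl
  ; m≡n+3         = refl
  }

K33Invariants-≅ : ∀ {G H} → G ≅ H → K33Invariants H → K33Invariants G
K33Invariants-≅ {G} {H} G≅H I = record
  { colour        = colour ∘ Inverse.to vmap
  ; colour-proper = proper
  ; 6≤n           = subst (6 ≤_) (sym (↔⇒≡ vmap)) 6≤n
  ; m≡n+3         = trans (↔⇒≡ emap) (trans m≡n+3 (cong (_+ 3) (sym (↔⇒≡ vmap))))
  }
  where
  open _≅_ G≅H
  open K33Invariants I

  proper : ProperColouring G (colour ∘ Inverse.to vmap)
  proper f = colour-proper (Inverse.to emap f)
           ∘ Identifies-resp-SameEnds {f = colour} (SameEnds-sym (inc f))

alternate : Bool → ℕ → Bool
alternate b zero    = b
alternate b (suc k) = not (alternate b k)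

alternate-even : ∀ b {j} → Even j → alternate b j ≡ b
alternate-even b (t , refl) = alternate-double t
  where
  alternate-double : ∀ t → alternate b (t + t) ≡ b
  alternate-double zero    = refl
  alternate-double (suc t) rewrite +-suc t t | not-involutive (alternate b (t + t)) =
    alternate-double t

-- The i-th new vertex gets the colour of the first end a flipped i + 1 times; since j is
-- even, the last one has the colour of a, which differs from that of the other end.
subdivisionColouring : (G : Graph) → (Vertex G → Bool) → (e : Edge G) (j : ℕ) →
                       Vertex (subdivide G e j) → Bool
subdivisionColouring G c e j v =
  [ c , (λ i → alternate (c (proj₁ (ends G e))) (suc (toℕ i))) ]′ (splitAt (n G) v)

subdivide-proper : ∀ {G c} → ProperColouring G c → ∀ e {j} → Even j →
                   ProperColouring (subdivide G e j) (subdivisionColouring G c e j)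
subdivide-proper {G} {c} c-proper e {j} j-even = proper
  where
  a = proj₁ (ends G e)
  b = proj₂ (ends G e)
  c' = subdivisionColouring G c e j

  c'-old : ∀ x → c' (x ↑ˡ j) ≡ c x
  c'-old x rewrite splitAt-↑ˡ (n G) x j = refl

  c'-new : ∀ {k} (k<j : k < j) → c' (n G ↑ʳ fromℕ< k<j) ≡ alternate (c a) (suc k)
  c'-new k<j rewrite splitAt-↑ʳ (n G) j (fromℕ< k<j) | toℕ-fromℕ< k<j = refl

  last-colour : ∀ {k} → k ≡ j → alternate (c a) k ≡ c a
  last-colour refl = alternate-even (c a) j-even

  proper : ProperColouring (subdivide G e j) c'
  proper f with splitAt (m G) f
  proper f | inj₁ f' with f' ≟ e
  proper f | inj₁ f' | no _
    rewrite c'-old (proj₁ (ends G f')) | c'-old (proj₂ (ends G f')) = c-proper f'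
  proper f | inj₁ f' | yes _ with 0 <? j
  ... | yes 0<j rewrite c'-old a | c'-new 0<j = not-¬ refl
  ... | no _    rewrite c'-old a | c'-old b   = c-proper e
  proper f | inj₂ i with toℕ i <? j | suc (toℕ i) <? j
  ... | yes i<j | yes 1+i<j rewrite c'-new i<j | c'-new 1+i<j = not-¬ refl
  ... | yes i<j | no 1+i≮j  rewrite c'-new i<j | c'-old b =
    c-proper e ∘ trans (sym (last-colour (≤-antisym i<j (≮⇒≥ 1+i≮j))))
  ... | no i≮j  | _ = contradiction (toℕ<n i) i≮j

K33Invariants-subdivide : ∀ {G} → K33Invariants G → ∀ e {j} → Even j →
                          K33Invariants (subdivide G e j)
K33Invariants-subdivide {G} I e {j} j-even = record
  { colour        = subdivisionColouring G colour e j
  ; colour-proper = subdivide-proper {G} colour-proper e j-even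
  ; 6≤n           = ≤-trans 6≤n (m≤m+n (n G) j)
  ; m≡n+3         = trans (cong (_+ j) m≡n+3) (xy∙z≈xz∙y (n G) 3 j)
  }
  where open K33Invariants I

evenSubdivision⇒K33Invariants : ∀ {H} → EvenSubdivisionOf K33 H → K33Invariants H
evenSubdivision⇒K33Invariants (step₁ e j j-even H≅S) =
  K33Invariants-≅ H≅S (K33Invariants-subdivide K33Invariants-K33 e j-even)
evenSubdivision⇒K33Invariants (stepₙ H' e j j-even H≅S) =
  K33Invariants-≅ H≅S (K33Invariants-subdivide (evenSubdivision⇒K33Invariants H') e j-even)

module _ (G : Graph) (χ : Vertex G → Bool) where

  monochromatic? : ∀ e → Dec (Identifies χ (ends G e))
  monochromatic? e = χ (proj₁ (ends G e)) Bool.≟ χ (proj₂ (ends G e))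

  monochromaticEnds : List (Vertex G × Vertex G)
  monochromaticEnds = mapᴸ (ends G) (filter monochromatic? (allFin (m G)))

  componentCount : ℕ
  componentCount = imageSize (lookup (componentLabels monochromaticEnds))

  bichromaticCount : ℕ
  bichromaticCount = count (isNo ∘ monochromatic?)

  excludesK33 : Bool
  excludesK33 = (componentCount <ᵇ 6) ∨ (componentCount + 3 <ᵇ bichromaticCount)

module _ {G H} (C : Contraction G H) (c : Vertex H → Bool) (c-proper : ProperColouring H c)
         {χ : Vertex G → Bool} (χ≗c∘φ : ∀ v → χ v ≡ c (Contraction.φ C v)) where

  open Contraction C

  monochromatic⇒contracted : ∀ {e} → Identifies χ (ends G e) → ψ e ≡ nothing
  monochromatic⇒contracted {e} χ-mono with ψ e in ψe
  ... | nothing = refl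
  ... | just f  = contradiction
    (Identifies-resp-SameEnds {f = c} (SameEnds-sym (ψ-kept ψe))
                                      (trans (sym (χ≗c∘φ _)) (trans χ-mono (χ≗c∘φ _))))
    (c-proper f)

  bichromatic⇒kept : ∀ {e} → ¬ Identifies χ (ends G e) → ∃ λ f → ψ e ≡ just f
  bichromatic⇒kept {e} χ-bi with ψ e in ψe
  ... | just f  = f , refl
  ... | nothing = contradiction
    (trans (χ≗c∘φ _) (trans (cong c (ψ-contracted ψe)) (sym (χ≗c∘φ _)))) χ-bi

  n≤componentCount : n H ≤ componentCount G χ
  n≤componentCount = ≤-imageSize (lookup L) φ φ∘L-surjective
    where
    L = componentLabels (monochromaticEnds G χ)

    φ∘L≗φ : ∀ v → φ (lookup L v) ≡ φ v
    φ∘L≗φ = componentLabels-respect φ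
      (map⁺ (All.map (ψ-contracted ∘ monochromatic⇒contracted)
                     (all-filter (monochromatic? G χ) (allFin (m G)))))

    φ∘L-surjective : Surjective _≡_ _≡_ (φ ∘ lookup L)
    φ∘L-surjective y with x , φx≡y ← φ-surjective y =
      x , λ { refl → trans (φ∘L≗φ x) (φx≡y refl) }

  bichromaticCount≤m : bichromaticCount G χ ≤ m H
  bichromaticCount≤m = count-≤ _ (λ _ bi → proj₁ (kept bi)) λ bi bi' eq →
    ψ-injective (proj₂ (kept bi)) (trans (proj₂ (kept bi')) (cong just (sym eq)))
    where
    kept : ∀ {e} → T (isNo (monochromatic? G χ e)) → ∃ λ f → ψ e ≡ just f
    kept = bichromatic⇒kept ∘ toWitnessFalse

bounds⇒¬excluded : ∀ {v c b} → 6 ≤ v → v ≤ c → b ≤ v + 3 →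
                   ¬ T ((c <ᵇ 6) ∨ (c + 3 <ᵇ b))
bounds⇒¬excluded {v} {c} {b} 6≤v v≤c b≤v+3 excluded with Equivalence.to T-∨ excluded
... | inj₁ c<6   = <⇒≱ (<ᵇ⇒< c 6 c<6) (≤-trans 6≤v v≤c)
... | inj₂ c+3<b = <⇒≱ (<ᵇ⇒< (c + 3) b c+3<b) (≤-trans b≤v+3 (+-monoˡ-≤ 3 v≤c))

excludesK33-sound : ∀ {G H} (C : Contraction G H) (I : K33Invariants H) {χ} →
                    (∀ v → χ v ≡ K33Invariants.colour I (Contraction.φ C v)) →
                    ¬ T (excludesK33 G χ)
excludesK33-sound {G} C I {χ} χ≗c∘φ = bounds⇒¬excluded 6≤n
  (n≤componentCount C colour colour-proper χ≗c∘φ)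
  (subst (bichromaticCount G χ ≤_) m≡n+3 (bichromaticCount≤m C colour colour-proper χ≗c∘φ))
  where open K33Invariants I

forAllVecs : ∀ n → (Vec Bool n → Bool) → Bool
forAllVecs zero    p = p []
forAllVecs (suc n) p = forAllVecs n (p ∘ (true ∷_)) ∧ forAllVecs n (p ∘ (false ∷_))

forAllVecs-sound : ∀ n {p} → forAllVecs n p ≡ true → ∀ v → T (p v)
forAllVecs-sound zero    all []          = Equivalence.from T-≡ all
forAllVecs-sound (suc n) all (true ∷ v)  = forAllVecs-sound n (∧-conicalˡ _ _ all) v
forAllVecs-sound (suc n) all (false ∷ v) = forAllVecs-sound n (∧-conicalʳ _ _ all) v

-- The hypothesis is an equation rather than T (…) because Agda checks refl against the
-- equation for Γ₁ and Γ₂ several times faster than tt against T (…).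
notReducibleToK33 : ∀ G → forAllVecs (n G) (excludesK33 G ∘ lookup) ≡ true →
                    ¬ ReducibleToEvenSubdivisionOfK33 G
notReducibleToK33 G all-excluded (H , G↝H , H-subdivides-K33) =
  excludesK33-sound C I (lookup∘tabulate (colour ∘ φ))
    (forAllVecs-sound (n G) all-excluded (tabulate (colour ∘ φ)))
  where
  C = reducible⇒contraction G↝H
  I = evenSubdivision⇒K33Invariants H-subdivides-K33
  open Contraction C
  open K33Invariants I

mainTheorem9 : ¬ ReducibleToEvenSubdivisionOfK33 Γ₁ × ¬ ReducibleToEvenSubdivisionOfK33 Γ₂
mainTheorem9 = notReducibleToK33 Γ₁ refl , notReducibleToK33 Γ₂ refl
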